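{- Let $G=(V,E)$ be a hedgegraph, $f:2^E\to\mathbb{Z}_{\ge0}$ its hedgegraph polymatroid, and $r:2^E\to\mathbb{Z}_{\ge0}$ the rank function of the matroid $(E,\mathcal{I}_G)$, where $\mathcal{I}_G=\{F\subseteq E:(V,F)\text{ can be trimmed into a forest}\}$. Then for every $A\subseteq E$, $r(A)=\min\{f(B)+|A\setminus B|: B\subseteq A\}$.
   Context: A hedgegraph $G=(V,E)$ consists of a finite vertex set $V$ and a finite set $E$ of hedges; each hedge is a set of hyperedges (subsets of $V$), the hyperedges within one hedge are pairwise vertex-disjoint, and no hyperedge belongs to two hedges. For $A\subseteq E$, $\#\mathrm{Comps}(V,A)$ is the number of connected components of the hypergraph on $V$ formed by all hyperedges of hedges in $A$, and $f(A)=|V|-\#\mathrm{Comps}(V,A)$. A trimming of a hedge $e$ chooses one hyperedge $h\in e$ and distinct $u,v\in h$ and replaces $e$ by the edge $\{u,v\}$; a trimming of $(V,F)$ trims every hedge in $F$; $(V,F)$ can be trimmed into a forest if some trimming is an acyclic multigraph. $(E,\mathcal{I}_G)$ is a matroid, and its rank function is $r(A)=\max\{|F|:F\subseteq A, F\in\mathcal{I}_G\}$. -}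

module Defs where

open import Data.Nat using (ℕ; suc; _+_; _∸_; _≤_)
open import Data.Fin using (Fin; zero; suc; fromℕ; inject₁)
open import Relation.Nullary using (¬_)
open import Data.Fin.Subset using (Subset; _∈_; _⊆_; _∩_; _─_; ∣_∣; Empty)
open import Data.Product using (Σ; ∃; _×_; _,_)
open import Data.Sum using (_⊎_)
open import Relation.Binary.PropositionalEquality using (_≡_; _≢_)
open import Relation.Binary.Construct.Closure.ReflexiveTransitive using (Star)
open import Function.Definitions using (Injective)

-- Hyperedges are indexed per hedge, so no hyperedge belongs to two hedges.

record Hedgegraph : Set where
  field
    n        : ℕ
    m        : ℕ
    size     : Fin m → ℕ
    hyp      : (e : Fin m) → Fin (size e) → Subset n
    disjoint : ∀ e (j j′ : Fin (size e)) → j ≢ j′ → Empty (hyp e j ∩ hyp e j′)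

open Hedgegraph public

module _ (G : Hedgegraph) where

  Adj : Subset (m G) → Fin (n G) → Fin (n G) → Set
  Adj A u v = Σ (Fin (m G)) λ e → e ∈ A × Σ (Fin (size G e)) λ j →
                u ∈ hyp G e j × v ∈ hyp G e j

  Conn : Subset (m G) → Fin (n G) → Fin (n G) → Set
  Conn A = Star (Adj A)

  -- #Comps(V, A) ≡ c : there is a set of c vertices containing exactly
  -- one vertex from every connected component.
  NumComps : Subset (m G) → ℕ → Set
  NumComps A c = Σ (Subset (n G)) λ S → ∣ S ∣ ≡ c
    × (∀ v → Σ (Fin (n G)) λ s → s ∈ S × Conn A v s)
    × (∀ s s′ → s ∈ S → s′ ∈ S → Conn A s s′ → s ≡ s′)

  PolyF : Subset (m G) → ℕ → Set
  PolyF A k = Σ ℕ λ c → NumComps A c × k ≡ n G ∸ c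

  record Trim (e : Fin (m G)) : Set where
    field
      hedgeIx : Fin (size G e)
      u v     : Fin (n G)
      u≢v     : u ≢ v
      u∈h     : u ∈ hyp G e hedgeIx
      v∈h     : v ∈ hyp G e hedgeIx

  open Trim public

  Trimming : Subset (m G) → Set
  Trimming F = (e : Fin (m G)) → e ∈ F → Trim e

  -- a cycle in the trimmed multigraph: k+1 ≥ 1 distinct vertices
  -- w 0, …, w k (with w (k+1) = w 0 closing it up) and k+1 distinct
  -- edges (hedges of F), edge i joining w i and w (i+1).
  Joins : ∀ {F} → Trimming F → (e : Fin (m G)) → e ∈ F → Fin (n G) → Fin (n G) → Set
  Joins τ e p x y = (u (τ e p) ≡ x × v (τ e p) ≡ y) ⊎ (u (τ e p) ≡ y × v (τ e p) ≡ x)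

  record Cycle {F : Subset (m G)} (τ : Trimming F) : Set where
    field
      len      : ℕ
      w        : Fin (suc (suc len)) → Fin (n G)
      closed   : w (fromℕ (suc len)) ≡ w zero
      w-inj    : Injective _≡_ _≡_ (λ (i : Fin (suc len)) → w (inject₁ i))
      edge     : Fin (suc len) → Fin (m G)
      edge-inj : Injective _≡_ _≡_ edge
      edge∈F   : ∀ i → edge i ∈ F
      joins    : ∀ i → Joins τ (edge i) (edge∈F i) (w (inject₁ i)) (w (suc i))

  Acyclic : ∀ {F} → Trimming F → Set
  Acyclic τ = ¬ Cycle τ

  Indep : Subset (m G) → Set
  Indep F = Σ (Trimming F) Acyclic

  Rank : Subset (m G) → ℕ → Set
  Rank A k = (Σ (Subset (m G)) λ F → F ⊆ A × Indep F × ∣ F ∣ ≡ k)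
           × (∀ F → F ⊆ A → Indep F → ∣ F ∣ ≤ k)

  MinBound : Subset (m G) → ℕ → Set
  MinBound A k = (Σ (Subset (m G)) λ B → B ⊆ A × Σ ℕ λ fB → PolyF B fB × k ≡ fB + ∣ A ─ B ∣)
               × (∀ B → B ⊆ A → ∀ fB → PolyF B fB → k ≤ fB + ∣ A ─ B ∣)

-- An independent F ⊆ A trims F ∩ B into a forest inside the components of
-- B, so |F ∩ B| ≤ f(B), and |F ∖ B| ≤ |A ∖ B|: this bounds r(A) from above.
-- The reverse inequality follows the classical proof of Rado's theorem. Give
-- every hedge a list of candidate trimmings, initially all of them, and seek a
-- forest of at most one candidate per hedge of A together with a cut B ⊆ A
-- whose bound f(B) + |A ∖ B| it attains. If a hedge e ∈ A has two candidates
-- t₁ and t₂, solve the systems without t₁ and without t₂, with cuts B₁ and B₂.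
-- A solution whose cut avoids e also solves the full system; otherwise
-- submodularity of the number of components, and |A ∖ ((B₁ ∩ B₂) − e)| =
-- |A ∖ (B₁ ∩ B₂)| + 1, show that B₁ ∪ B₂ or (B₁ ∩ B₂) − e is attained by one
-- of the two forests. Once every hedge has at most one candidate the
-- hedgegraph is a graph, and a greedy spanning forest attains the bound for B = A.

module Submission where

open import Defs
open import Data.Fin.Subset using (Subset)
open import Data.Nat using (ℕ)
open import Data.Product using (Σ; _×_)

open import Data.Nat using (zero; suc; _+_; _∸_; _≤_; _<_; z≤n; s≤s; _≤?_; s≤s⁻¹)
open import Data.Nat.Properties
open import Data.Fin as F using (Fin; zero; suc; inject₁; fromℕ)
open import Data.Fin.Properties as FP using (any?)
open import Data.Fin.Subset as SS using (inside; outside; ∣_∣; _─_; _∪_; _∩_; _-_; ⁅_⁆; _∈_; _∉_; _⊆_; Nonempty)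
open import Data.Fin.Subset.Properties as SP
  using (_∈?_; nonempty?; ∈⊤; ∣⊤∣≡n; x∈p∩q⁺; x∈p∪q⁻; x∈p∧x∉q⇒x∈p─q; x∈p∧x≢y⇒x∈p-y; ∣p∣≤n; drop-there)
open import Data.Vec as V using ([]; _∷_; here; there)
open import Data.Vec.Properties using (lookup∘tabulate; []=⇒lookup; lookup⇒[]=)
open import Data.Bool using (true; not)
open import Data.Product using (_,_; proj₁; proj₂)
open import Data.Sum using (_⊎_; inj₁; inj₂; [_,_])
open import Data.Empty using (⊥; ⊥-elim)
open import Relation.Nullary using (¬_; yes; no)
open import Relation.Nullary.Decidable using (_×-dec_)
import Relation.Binary.Construct.On as On
open import Induction.WellFounded using (module All)
open import Data.Nat.Induction using (<-wellFounded)
open import Relation.Binary.PropositionalEquality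
  using (_≡_; _≢_; refl; sym; trans; cong; cong₂; subst; subst₂; module ≡-Reasoning)
open import Relation.Binary.Construct.Closure.ReflexiveTransitive using (Star; ε; _◅_; _◅◅_; reverse; _⋆)
open import Function using (_∘_; id)
open import Data.Unit using (⊤; tt)
open import Data.List as L using (List; []; _∷_; _++_; length; map)
open import Data.List.Properties using (length-++; length-map; map-++; ++-identityʳ; tabulate-cong)
open import Data.List.Relation.Unary.Any using (here; there)
open import Data.List.Membership.Propositional using () renaming (_∈_ to _∈ₗ_)
open import Data.List.Membership.Propositional.Properties
  using (∈-++⁺ˡ; ∈-++⁺ʳ; ∈-++⁻; ∈-insert; ∈-∃++; ∈-map⁺; ∈-map⁻; ∈-lookup; ∈-concat⁺; ∈-concat⁻; ∉[])
open import Data.List.Relation.Unary.Any.Properties using (tabulate⁺; tabulate⁻)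
import Data.List.Relation.Binary.Sublist.Propositional as Sublist
open Sublist using ([]; _∷_; _∷ʳ_) renaming (_⊆_ to _⊑_; ⊆-refl to ⊑-refl)
open import Data.List.Relation.Binary.Sublist.Propositional.Properties using (++⁺; ++⁺ˡ)
open import Relation.Binary.Core using (_⇒_)
open import Relation.Binary.Definitions using (Symmetric; Decidable)
open import Data.Nat.Tactic.RingSolver using (solve-∀)
open import Algebra.Properties.CommutativeSemigroup +-commutativeSemigroup
  using () renaming (interchange to +-interchange; xy∙z≈xz∙y to +-xy∙z≈xz∙y)

≤-split : ∀ x y p q → x + y ≤ suc (p + q) → x ≤ p ⊎ y ≤ q
≤-split x y p q x+y≤ with x ≤? p | y ≤? q
... | yes x≤p | _ = inj₁ x≤p
... | no _ | yes y≤q = inj₂ y≤q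
... | no x≰p | no y≰q = ⊥-elim (1+n≰n (begin-strict
  suc (p + q)            <⟨ s≤s (+-monoʳ-< p (≰⇒> y≰q)) ⟩
  suc (p + y)            ≤⟨ +-monoˡ-≤ y (≰⇒> x≰p) ⟩
  x + y                  ≤⟨ x+y≤ ⟩
  suc (p + q)            ∎))
  where open ≤-Reasoning

n∸c+d+c≡n+d : ∀ {n c} d → c ≤ n → n ∸ c + d + c ≡ n + d
n∸c+d+c≡n+d {n} {c} d c≤n = begin
  n ∸ c + d + c     ≡⟨ +-assoc (n ∸ c) d c ⟩
  n ∸ c + (d + c)   ≡⟨ cong (n ∸ c +_) (+-comm d c) ⟩
  n ∸ c + (c + d)   ≡⟨ sym (+-assoc (n ∸ c) c d) ⟩
  n ∸ c + c + d     ≡⟨ cong (_+ d) (m∸n+n≡m c≤n) ⟩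
  n + d             ∎
  where open ≡-Reasoning

k+c≤n+d⇒k≤n∸c+d : ∀ {k c n} d → c ≤ n → k + c ≤ n + d → k ≤ n ∸ c + d
k+c≤n+d⇒k≤n∸c+d {k} {c} {n} d c≤n h = +-cancelʳ-≤ c k (n ∸ c + d) (subst (k + c ≤_) (sym (n∸c+d+c≡n+d d c≤n)) h)

n+d≤k+c⇒n∸c+d≤k : ∀ {k c n} d → c ≤ n → n + d ≤ k + c → n ∸ c + d ≤ k
n+d≤k+c⇒n∸c+d≤k {k} {c} {n} d c≤n h = +-cancelʳ-≤ c (n ∸ c + d) k (subst (_≤ k + c) (sym (n∸c+d+c≡n+d d c≤n)) h)

x∈p─q⁻ : ∀ {k} {x : Fin k} (p q : Subset k) → x ∈ p ─ q → x ∈ p × x ∉ q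
x∈p─q⁻ {x = zero} (inside ∷ p) (outside ∷ q) here = here , λ ()
x∈p─q⁻ {x = suc x} (_ ∷ p) (_ ∷ q) (there r) with x∈p─q⁻ p q r
... | x∈p , x∉q = there x∈p , λ { (there x∈q) → x∉q x∈q }

x∈p-y⁻ : ∀ {k} {x y : Fin k} {p : Subset k} → x ∈ p - y → x ∈ p × x ≢ y
x∈p-y⁻ {y = y} {p} x∈ with x∈p─q⁻ p ⁅ y ⁆ x∈
... | x∈p , x∉y = x∈p , λ { refl → x∉y (SP.x∈⁅x⁆ y) }

∣p∣≡1+∣p-x∣ : ∀ {k} {x : Fin k} (p : Subset k) → x ∈ p → ∣ p ∣ ≡ suc ∣ p - x ∣
∣p∣≡1+∣p-x∣ {x = zero} (inside ∷ p) here = cong suc (cong ∣_∣ (sym (SP.p─⊥≡p p)))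
∣p∣≡1+∣p-x∣ {x = suc x} (inside ∷ p) (there x∈p) = cong suc (∣p∣≡1+∣p-x∣ p x∈p)
∣p∣≡1+∣p-x∣ {x = suc x} (outside ∷ p) (there x∈p) = ∣p∣≡1+∣p-x∣ p x∈p

¬Nonempty⇒∣p∣≡0 : ∀ {k} (p : Subset k) → ¬ Nonempty p → ∣ p ∣ ≡ 0
¬Nonempty⇒∣p∣≡0 {k} p p≡∅ rewrite SP.Empty-unique p≡∅ = SP.∣⊥∣≡0 k

∈-irrelevant : ∀ {k} {x : Fin k} {p : Subset k} (a b : x ∈ p) → a ≡ b
∈-irrelevant here here = refl
∈-irrelevant (there a) (there b) = cong there (∈-irrelevant a b)

injectiveOn⇒∣p∣≤∣q∣ : ∀ {k} (p q : Subset k) (f : Fin k → Fin k) → (∀ x → x ∈ p → f x ∈ q) →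
                      (∀ x y → x ∈ p → y ∈ p → f x ≡ f y → x ≡ y) → ∣ p ∣ ≤ ∣ q ∣
injectiveOn⇒∣p∣≤∣q∣ p q f into inj = go ∣ p ∣ p q refl into inj
  where
  go : ∀ j p q → ∣ p ∣ ≡ j → (∀ x → x ∈ p → f x ∈ q) →
       (∀ x y → x ∈ p → y ∈ p → f x ≡ f y → x ≡ y) → j ≤ ∣ q ∣
  go zero p q _ _ _ = z≤n
  go (suc j) p q ∣p∣≡ into inj with nonempty? p
  ... | no p≡∅ = ⊥-elim (0≢1+n (trans (sym (¬Nonempty⇒∣p∣≡0 p p≡∅)) ∣p∣≡))
  ... | yes (x , x∈p) = subst (suc j ≤_) (sym (∣p∣≡1+∣p-x∣ q (into x x∈p))) (s≤s
        (go j (p - x) (q - f x) (suc-injective (trans (sym (∣p∣≡1+∣p-x∣ p x∈p)) ∣p∣≡))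
          (λ y y∈ → let y∈p , y≢x = x∈p-y⁻ y∈ in
             x∈p∧x≢y⇒x∈p-y (into y y∈p) (λ fy≡fx → y≢x (inj y x y∈p x∈p fy≡fx)))
          (λ y z y∈ z∈ → inj y z (proj₁ (x∈p-y⁻ y∈)) (proj₁ (x∈p-y⁻ z∈)))))

∣p─q∣+∣p─r∣≡∣p─q∪r∣+∣p─q∩r∣ : ∀ {k} (p q r : Subset k) → ∣ p ─ q ∣ + ∣ p ─ r ∣ ≡ ∣ p ─ (q ∪ r) ∣ + ∣ p ─ (q ∩ r) ∣
∣p─q∣+∣p─r∣≡∣p─q∪r∣+∣p─q∩r∣ [] [] [] = refl
∣p─q∣+∣p─r∣≡∣p─q∪r∣+∣p─q∩r∣ (outside ∷ p) (inside ∷ q) (inside ∷ r) = ∣p─q∣+∣p─r∣≡∣p─q∪r∣+∣p─q∩r∣ p q r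
∣p─q∣+∣p─r∣≡∣p─q∪r∣+∣p─q∩r∣ (outside ∷ p) (inside ∷ q) (outside ∷ r) = ∣p─q∣+∣p─r∣≡∣p─q∪r∣+∣p─q∩r∣ p q r
∣p─q∣+∣p─r∣≡∣p─q∪r∣+∣p─q∩r∣ (outside ∷ p) (outside ∷ q) (inside ∷ r) = ∣p─q∣+∣p─r∣≡∣p─q∪r∣+∣p─q∩r∣ p q r
∣p─q∣+∣p─r∣≡∣p─q∪r∣+∣p─q∩r∣ (outside ∷ p) (outside ∷ q) (outside ∷ r) = ∣p─q∣+∣p─r∣≡∣p─q∪r∣+∣p─q∩r∣ p q r
∣p─q∣+∣p─r∣≡∣p─q∪r∣+∣p─q∩r∣ (inside ∷ p) (inside ∷ q) (inside ∷ r) = ∣p─q∣+∣p─r∣≡∣p─q∪r∣+∣p─q∩r∣ p q r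
∣p─q∣+∣p─r∣≡∣p─q∪r∣+∣p─q∩r∣ (inside ∷ p) (inside ∷ q) (outside ∷ r) =
  trans (+-suc ∣ p ─ q ∣ ∣ p ─ r ∣) (trans (cong suc (∣p─q∣+∣p─r∣≡∣p─q∪r∣+∣p─q∩r∣ p q r)) (sym (+-suc _ _)))
∣p─q∣+∣p─r∣≡∣p─q∪r∣+∣p─q∩r∣ (inside ∷ p) (outside ∷ q) (inside ∷ r) =
  trans (cong suc (∣p─q∣+∣p─r∣≡∣p─q∪r∣+∣p─q∩r∣ p q r)) (sym (+-suc _ _))
∣p─q∣+∣p─r∣≡∣p─q∪r∣+∣p─q∩r∣ (inside ∷ p) (outside ∷ q) (outside ∷ r) =
  cong suc (trans (+-suc ∣ p ─ q ∣ ∣ p ─ r ∣) (trans (cong suc (∣p─q∣+∣p─r∣≡∣p─q∪r∣+∣p─q∩r∣ p q r)) (sym (+-suc _ _))))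

∣p─[q-x]∣≡1+∣p─q∣ : ∀ {k} (p q : Subset k) {x : Fin k} → x ∈ p → x ∈ q → ∣ p ─ (q - x) ∣ ≡ suc ∣ p ─ q ∣
∣p─[q-x]∣≡1+∣p─q∣ (inside ∷ p) (inside ∷ q) here here = cong suc (cong (λ r → ∣ p ─ r ∣) (SP.p─⊥≡p q))
∣p─[q-x]∣≡1+∣p─q∣ (inside ∷ p) (inside ∷ q) (there x∈p) (there x∈q) = ∣p─[q-x]∣≡1+∣p─q∣ p q x∈p x∈q
∣p─[q-x]∣≡1+∣p─q∣ (outside ∷ p) (inside ∷ q) (there x∈p) (there x∈q) = ∣p─[q-x]∣≡1+∣p─q∣ p q x∈p x∈q
∣p─[q-x]∣≡1+∣p─q∣ (outside ∷ p) (outside ∷ q) (there x∈p) (there x∈q) = ∣p─[q-x]∣≡1+∣p─q∣ p q x∈p x∈q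
∣p─[q-x]∣≡1+∣p─q∣ (inside ∷ p) (outside ∷ q) (there x∈p) (there x∈q) = cong suc (∣p─[q-x]∣≡1+∣p─q∣ p q x∈p x∈q)

∣p─p∣≡0 : ∀ {k} (p : Subset k) → ∣ p ─ p ∣ ≡ 0
∣p─p∣≡0 [] = refl
∣p─p∣≡0 (inside ∷ p) = ∣p─p∣≡0 p
∣p─p∣≡0 (outside ∷ p) = ∣p─p∣≡0 p

module _ {n : ℕ} where

  Components : (Fin n → Fin n → Set) → ℕ → Set
  Components R c = Σ (Subset n) λ S → ∣ S ∣ ≡ c
    × (∀ v → Σ (Fin n) λ s → s ∈ S × Star R v s)
    × (∀ s s′ → s ∈ S → s′ ∈ S → Star R s s′ → s ≡ s′)

  components-antitone : ∀ {R R′ : Fin n → Fin n → Set} → Symmetric R → Star R ⇒ Star R′ →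
                        ∀ {c d} → Components R c → Components R′ d → d ≤ c
  components-antitone {R} symR R⇒R′ (S , refl , cover , distinct) (S′ , refl , cover′ , distinct′) =
    injectiveOn⇒∣p∣≤∣q∣ S′ S rep (λ s _ → proj₁ (proj₂ (cover s))) rep-injective
    where
    rep : Fin n → Fin n
    rep v = proj₁ (cover v)
    rep-injective : ∀ s s′ → s ∈ S′ → s′ ∈ S′ → rep s ≡ rep s′ → s ≡ s′
    rep-injective s s′ s∈ s′∈ eq = distinct′ s s′ s∈ s′∈ (R⇒R′ (proj₂ (proj₂ (cover s)) ◅◅
        reverse symR (subst (Star R s′) (sym eq) (proj₂ (proj₂ (cover s′))))))

  components-resp : ∀ {R R′ : Fin n → Fin n → Set} → Star R ⇒ Star R′ → Star R′ ⇒ Star R →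
                    ∀ {c} → Components R c → Components R′ c
  components-resp R⇒R′ R′⇒R (S , ∣S∣ , cover , distinct) =
    S , ∣S∣ , (λ v → let s , s∈ , v~s = cover v in s , s∈ , R⇒R′ v~s) ,
    (λ s s′ s∈ s′∈ s~s′ → distinct s s′ s∈ s′∈ (R′⇒R s~s′))

  components-≤ : ∀ {R : Fin n → Fin n → Set} {c} → Components R c → c ≤ n
  components-≤ (S , refl , _) = ∣p∣≤n S

  components⇒decidable : ∀ {R : Fin n → Fin n → Set} → Symmetric R → ∀ {c} → Components R c →
                         Decidable (Star R)
  components⇒decidable symR (S , _ , cover , distinct) a b with cover a | cover b
  ... | s , s∈ , a~s | s′ , s′∈ , b~s′ with s F.≟ s′
  ... | yes refl = yes (a~s ◅◅ reverse symR b~s′)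
  ... | no s≢s′ = no λ a~b → s≢s′ (distinct s s′ s∈ s′∈ (reverse symR a~s ◅◅ a~b ◅◅ b~s′))

module _ {X : Set} where

  concatFin : ∀ {k} → (Fin k → List X) → List X
  concatFin f = L.concat (L.tabulate f)

  ∈-concatFin⁺ : ∀ {k} (f : Fin k → List X) i {z} → z ∈ₗ f i → z ∈ₗ concatFin f
  ∈-concatFin⁺ f i z∈ = ∈-concat⁺ (tabulate⁺ i z∈)

  ∈-concatFin⁻ : ∀ {k} (f : Fin k → List X) {z} → z ∈ₗ concatFin f → Σ (Fin k) λ i → z ∈ₗ f i
  ∈-concatFin⁻ f z∈ = tabulate⁻ (∈-concat⁻ (L.tabulate f) z∈)

  concatFin-cong : ∀ {k} (f g : Fin k → List X) → (∀ i → f i ≡ g i) → concatFin f ≡ concatFin g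
  concatFin-cong f g f≗g = cong L.concat (tabulate-cong f≗g)

  concatFin-⊑ : ∀ {k} (f g : Fin k → List X) → (∀ i → f i ⊑ g i) → concatFin f ⊑ concatFin g
  concatFin-⊑ {zero} f g h = []
  concatFin-⊑ {suc k} f g h = ++⁺ (h zero) (concatFin-⊑ (f ∘ suc) (g ∘ suc) (h ∘ suc))

  length-concatFin-split : ∀ {k} (f g h : Fin k → List X) → (∀ i → length (f i) ≡ length (g i) + length (h i)) →
                           length (concatFin f) ≡ length (concatFin g) + length (concatFin h)
  length-concatFin-split {zero} f g h split = refl
  length-concatFin-split {suc k} f g h split = begin
    length (f zero ++ concatFin (f ∘ suc))
      ≡⟨ length-++ (f zero) ⟩
    length (f zero) + length (concatFin (f ∘ suc))
      ≡⟨ cong₂ _+_ (split zero) (length-concatFin-split (f ∘ suc) (g ∘ suc) (h ∘ suc) (split ∘ suc)) ⟩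
    (length (g zero) + length (h zero)) + (length (concatFin (g ∘ suc)) + length (concatFin (h ∘ suc)))
      ≡⟨ +-interchange (length (g zero)) (length (h zero)) _ _ ⟩
    (length (g zero) + length (concatFin (g ∘ suc))) + (length (h zero) + length (concatFin (h ∘ suc)))
      ≡⟨ sym (cong₂ _+_ (length-++ (g zero)) (length-++ (h zero))) ⟩
    length (concatFin g) + length (concatFin h) ∎
    where open ≡-Reasoning

  length-concatFin≤ : ∀ {k} (f : Fin k → List X) (S : Subset k) → (∀ i → length (f i) ≤ 1) →
                      (∀ i → i ∉ S → f i ≡ []) → length (concatFin f) ≤ ∣ S ∣
  length-concatFin≤ {zero} f [] _ _ = z≤n
  length-concatFin≤ {suc k} f (inside ∷ S) ≤1 outside-S =
    subst (_≤ suc ∣ S ∣) (sym (length-++ (f zero)))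
      (+-mono-≤ (≤1 zero) (length-concatFin≤ (f ∘ suc) S (≤1 ∘ suc) (λ i i∉ → outside-S (suc i) (i∉ ∘ drop-there))))
  length-concatFin≤ {suc k} f (outside ∷ S) ≤1 outside-S rewrite outside-S zero (λ ()) =
    length-concatFin≤ (f ∘ suc) S (≤1 ∘ suc) (λ i i∉ → outside-S (suc i) (i∉ ∘ drop-there))

  length-concatFin≡ : ∀ {k} (f : Fin k → List X) (S : Subset k) → (∀ i → i ∈ S → length (f i) ≡ 1) →
                      (∀ i → i ∉ S → f i ≡ []) → length (concatFin f) ≡ ∣ S ∣
  length-concatFin≡ {zero} f [] _ _ = refl
  length-concatFin≡ {suc k} f (inside ∷ S) ≡1 outside-S =
    trans (length-++ (f zero)) (cong₂ _+_ (≡1 zero here)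
      (length-concatFin≡ (f ∘ suc) S (λ i i∈ → ≡1 (suc i) (there i∈)) (λ i i∉ → outside-S (suc i) (i∉ ∘ drop-there))))
  length-concatFin≡ {suc k} f (outside ∷ S) ≡1 outside-S rewrite outside-S zero (λ ()) =
    length-concatFin≡ (f ∘ suc) S (λ i i∈ → ≡1 (suc i) (there i∈)) (λ i i∉ → outside-S (suc i) (i∉ ∘ drop-there))

sumFin : ∀ {k} → (Fin k → ℕ) → ℕ
sumFin {zero} f = 0
sumFin {suc k} f = f zero + sumFin (f ∘ suc)

sumFin-mono-≤ : ∀ {k} (f g : Fin k → ℕ) → (∀ i → f i ≤ g i) → sumFin f ≤ sumFin g
sumFin-mono-≤ {zero} f g h = z≤n
sumFin-mono-≤ {suc k} f g h = +-mono-≤ (h zero) (sumFin-mono-≤ (f ∘ suc) (g ∘ suc) (h ∘ suc))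

sumFin-mono-< : ∀ {k} (f g : Fin k → ℕ) → (∀ i → f i ≤ g i) → ∀ j → f j < g j → sumFin f < sumFin g
sumFin-mono-< {suc k} f g h zero lt = +-mono-<-≤ lt (sumFin-mono-≤ (f ∘ suc) (g ∘ suc) (h ∘ suc))
sumFin-mono-< {suc k} f g h (suc j) lt = +-mono-≤-< (h zero) (sumFin-mono-< (f ∘ suc) (g ∘ suc) (h ∘ suc) j lt)

∈-++-insert : ∀ {X : Set} pre {x : X} {post z} → z ∈ₗ pre ++ post → z ∈ₗ pre ++ x ∷ post
∈-++-insert pre z∈ with ∈-++⁻ pre z∈
... | inj₁ q = ∈-++⁺ˡ q
... | inj₂ q = ∈-++⁺ʳ pre (there q)

∈-++-remove : ∀ {X : Set} pre {x : X} post {z} → z ∈ₗ pre ++ x ∷ post → z ≢ x → z ∈ₗ pre ++ post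
∈-++-remove pre post z∈ z≢x with ∈-++⁻ pre z∈
... | inj₁ q = ∈-++⁺ˡ q
... | inj₂ (here z≡x) = ⊥-elim (z≢x z≡x)
... | inj₂ (there q) = ∈-++⁺ʳ pre q

module Multigraph {n : ℕ} {X : Set} (eu ev : X → Fin n) where

  Ends : X → Fin n → Fin n → Set
  Ends z a b = (eu z ≡ a × ev z ≡ b) ⊎ (eu z ≡ b × ev z ≡ a)

  Edge : List X → Fin n → Fin n → Set
  Edge L a b = Σ X λ z → z ∈ₗ L × Ends z a b

  Path : List X → Fin n → Fin n → Set
  Path L = Star (Edge L)

  edge-sym : ∀ {L} → Symmetric (Edge L)
  edge-sym (z , z∈ , inj₁ (p , q)) = z , z∈ , inj₂ (p , q)
  edge-sym (z , z∈ , inj₂ (p , q)) = z , z∈ , inj₁ (p , q)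

  path-sym : ∀ {L} → Symmetric (Path L)
  path-sym = reverse edge-sym

  edge⇒path : ∀ {L z} → z ∈ₗ L → Path L (eu z) (ev z)
  edge⇒path {z = z} z∈ = (z , z∈ , inj₁ (refl , refl)) ◅ ε

  path-lift : ∀ {L} {R : Fin n → Fin n → Set} → Symmetric R →
              (∀ {z} → z ∈ₗ L → Star R (eu z) (ev z)) → Path L ⇒ Star R
  path-lift {R = R} symR h = step ⋆
    where
    step : Edge _ ⇒ Star R
    step (_ , z∈ , inj₁ (refl , refl)) = h z∈
    step (_ , z∈ , inj₂ (refl , refl)) = reverse symR (h z∈)

  path-mono : ∀ {L₁ L₂} → (∀ {z} → z ∈ₗ L₁ → z ∈ₗ L₂) → Path L₁ ⇒ Path L₂
  path-mono h = path-lift edge-sym (edge⇒path ∘ h)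

  path-∷⁻ : ∀ x L {s t} → Path (x ∷ L) s t →
            Path L s t ⊎ (Path L s (eu x) × Path L (ev x) t) ⊎ (Path L s (ev x) × Path L (eu x) t)
  path-∷⁻ x L ε = inj₁ ε
  path-∷⁻ x L ((z , here refl , inj₁ (refl , refl)) ◅ p) with path-∷⁻ x L p
  ... | inj₁ q = inj₂ (inj₁ (ε , q))
  ... | inj₂ (inj₁ (q , r)) = inj₁ (path-sym q ◅◅ r)
  ... | inj₂ (inj₂ (q , r)) = inj₁ r
  path-∷⁻ x L ((z , here refl , inj₂ (refl , refl)) ◅ p) with path-∷⁻ x L p
  ... | inj₁ q = inj₂ (inj₂ (ε , q))
  ... | inj₂ (inj₁ (q , r)) = inj₁ r
  ... | inj₂ (inj₂ (q , r)) = inj₁ (path-sym q ◅◅ r)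
  path-∷⁻ x L ((z , there z∈ , o) ◅ p) with path-∷⁻ x L p
  ... | inj₁ q = inj₁ ((z , z∈ , o) ◅ q)
  ... | inj₂ (inj₁ (q , r)) = inj₂ (inj₁ ((z , z∈ , o) ◅ q , r))
  ... | inj₂ (inj₂ (q , r)) = inj₂ (inj₂ ((z , z∈ , o) ◅ q , r))

  Forest : List X → Set
  Forest [] = ⊤
  Forest (x ∷ L) = ¬ Path L (eu x) (ev x) × Forest L

  forest-components : ∀ L → Forest L → Σ ℕ λ c → Components (Edge L) c × c + length L ≡ n
  forest-components [] _ = n , (SS.⊤ , ∣⊤∣≡n n , (λ v → v , ∈⊤ , ε) , distinct) , +-identityʳ n
    where
    distinct : ∀ s s′ → s ∈ SS.⊤ → s′ ∈ SS.⊤ → Path [] s s′ → s ≡ s′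
    distinct s .s _ _ ε = refl
    distinct s s′ _ _ ((_ , () , _) ◅ _)
  -- x merges the components of its two ends; the representative on the ev side is dropped.
  forest-components (x ∷ L) (x-joins , forest) with forest-components L forest
  ... | c , (S , ∣S∣ , cover , distinct) , c+∣L∣ = ∣ S - sb ∣ , (S - sb , refl , cover′ , distinct′) , count
    where
    sa sb : Fin n
    sa = proj₁ (cover (eu x))
    sb = proj₁ (cover (ev x))
    sa∈ : sa ∈ S
    sa∈ = proj₁ (proj₂ (cover (eu x)))
    sb∈ : sb ∈ S
    sb∈ = proj₁ (proj₂ (cover (ev x)))
    a~sa : Path L (eu x) sa
    a~sa = proj₂ (proj₂ (cover (eu x)))
    b~sb : Path L (ev x) sb
    b~sb = proj₂ (proj₂ (cover (ev x)))
    up : Path L ⇒ Path (x ∷ L)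
    up = path-mono there
    sa≢sb : sa ≢ sb
    sa≢sb sa≡sb = x-joins (a~sa ◅◅ subst (Path L sa) sa≡sb ε ◅◅ path-sym b~sb)
    count : ∣ S - sb ∣ + suc (length L) ≡ n
    count = trans (+-suc _ _) (trans (cong (_+ length L) (trans (sym (∣p∣≡1+∣p-x∣ S sb∈)) ∣S∣)) c+∣L∣)
    cover′ : ∀ v → Σ (Fin n) λ s → s ∈ S - sb × Path (x ∷ L) v s
    cover′ v with cover v
    ... | s , s∈ , v~s with s F.≟ sb
    ... | yes s≡sb = sa , x∈p∧x≢y⇒x∈p-y sa∈ sa≢sb ,
                     up (v~s ◅◅ subst (Path L s) s≡sb ε ◅◅ path-sym b~sb) ◅◅ path-sym (edge⇒path (here refl)) ◅◅ up a~sa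
    ... | no s≢sb = s , x∈p∧x≢y⇒x∈p-y s∈ s≢sb , up v~s
    distinct′ : ∀ s s′ → s ∈ S - sb → s′ ∈ S - sb → Path (x ∷ L) s s′ → s ≡ s′
    distinct′ s s′ s∈ s′∈ p with x∈p-y⁻ s∈ | x∈p-y⁻ s′∈ | path-∷⁻ x L p
    ... | s∈S , _ | s′∈S , _ | inj₁ q = distinct s s′ s∈S s′∈S q
    ... | _ | s′∈S , s′≢sb | inj₂ (inj₁ (_ , r)) = ⊥-elim (s′≢sb (distinct s′ sb s′∈S sb∈ (path-sym r ◅◅ b~sb)))
    ... | s∈S , s≢sb | _ | inj₂ (inj₂ (q , _)) = ⊥-elim (s≢sb (distinct s sb s∈S sb∈ (q ◅◅ b~sb)))

  path? : ∀ L → Forest L → Decidable (Path L)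
  path? L forest = components⇒decidable edge-sym (proj₁ (proj₂ (forest-components L forest)))

  forest-⊑ : ∀ {L₁ L₂} → L₁ ⊑ L₂ → Forest L₂ → Forest L₁
  forest-⊑ [] _ = tt
  forest-⊑ (x ∷ʳ L₁⊑L₂) (_ , forest) = forest-⊑ L₁⊑L₂ forest
  forest-⊑ (refl ∷ L₁⊑L₂) (x-joins , forest) =
    x-joins ∘ path-mono (Sublist.lookup L₁⊑L₂) , forest-⊑ L₁⊑L₂ forest

  forest-length+components≤n : ∀ L {R : Fin n → Fin n → Set} → Symmetric R → Forest L →
                               (∀ {z} → z ∈ₗ L → Star R (eu z) (ev z)) →
                               ∀ {c} → Components R c → length L + c ≤ n
  forest-length+components≤n L symR forest h compR with forest-components L forest
  ... | c′ , compL , c′+∣L∣ = subst (length L + _ ≤_) (trans (+-comm (length L) c′) c′+∣L∣)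
        (+-monoʳ-≤ (length L) (components-antitone edge-sym (path-lift symR h) compL compR))

  greedy-forest : ∀ T → Forest T → (C : List X) → Σ (List X) λ T′ → Forest (T′ ++ T) ×
                  (∀ {z} → z ∈ₗ T′ → z ∈ₗ C) × (∀ {z} → z ∈ₗ C → Path (T′ ++ T) (eu z) (ev z))
  greedy-forest T forest [] = [] , forest , (λ ()) , (λ ())
  greedy-forest T forest (z ∷ C) with greedy-forest T forest C
  ... | T′ , forest′ , T′⊆C , spans with path? (T′ ++ T) forest′ (eu z) (ev z)
  ... | yes p = T′ , forest′ , there ∘ T′⊆C , λ { (here refl) → p ; (there q) → spans q }
  ... | no ¬p = z ∷ T′ , (¬p , forest′) , (λ { (here refl) → here refl ; (there q) → there (T′⊆C q) }) ,
                λ { (here refl) → edge⇒path (here refl) ; (there q) → path-mono there (spans q) }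

  spanning-forest : ∀ C → Σ (List X) λ T → Forest T ×
                    (∀ {z} → z ∈ₗ T → z ∈ₗ C) × (∀ {z} → z ∈ₗ C → Path T (eu z) (ev z))
  spanning-forest C with greedy-forest [] tt C
  ... | T , forest , T⊆C , spans rewrite ++-identityʳ T = T , forest , T⊆C , spans

  components-exist : ∀ L → Σ ℕ λ c → Components (Edge L) c
  components-exist L with spanning-forest L
  ... | T , forest , T⊆L , spans with forest-components T forest
  ... | c , compT , _ = c , components-resp (path-mono T⊆L) (path-lift edge-sym spans) compT

  n≤components+length : ∀ T C → Forest T → (∀ {z} → z ∈ₗ C → Path T (eu z) (ev z)) →
                        ∀ {c} → Components (Edge C) c → n ≤ c + length T
  n≤components+length T C forest spans compC with forest-components T forest
  ... | c′ , compT , c′+∣T∣ = subst (_≤ _ + length T) c′+∣T∣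
        (+-monoˡ-≤ (length T) (components-antitone edge-sym (path-lift edge-sym spans) compC compT))

  forest-++-length+components≤n : ∀ T F {L} → Forest (T ++ F) → (∀ {z} → z ∈ₗ T → z ∈ₗ L) →
                                  (∀ {z} → z ∈ₗ F → z ∈ₗ L) → ∀ {c} → Components (Edge L) c →
                                  length T + length F + c ≤ n
  forest-++-length+components≤n T F forest T⊆L F⊆L comp =
    subst (λ k → k + _ ≤ n) (length-++ T) (forest-length+components≤n (T ++ F) edge-sym forest inL comp)
    where
    inL : ∀ {z} → z ∈ₗ T ++ F → Path _ (eu z) (ev z)
    inL z∈ = edge⇒path ([ T⊆L , F⊆L ] (∈-++⁻ T z∈))

  -- One forest is grown in three stages: F spans L∩, then T₂ ⊆ L₂ and
  -- T₁ ⊆ L₁ are added greedily; each stage is counted against components.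
  components-submodular : ∀ (L₁ L₂ L∪ L∩ : List X) → (∀ {z} → z ∈ₗ L∪ → z ∈ₗ L₁ ⊎ z ∈ₗ L₂) →
                          (∀ {z} → z ∈ₗ L∩ → z ∈ₗ L₁) → (∀ {z} → z ∈ₗ L∩ → z ∈ₗ L₂) →
                          ∀ {c₁ c₂ c∪ c∩} → Components (Edge L₁) c₁ → Components (Edge L₂) c₂ →
                          Components (Edge L∪) c∪ → Components (Edge L∩) c∩ → c₁ + c₂ ≤ c∪ + c∩
  components-submodular L₁ L₂ L∪ L∩ ∪⊆ ∩⊆₁ ∩⊆₂ {c₁} {c₂} {c∪} {c∩} comp₁ comp₂ comp∪ comp∩
    with spanning-forest L∩
  ... | F , forestF , F⊆ , spansF with greedy-forest F forestF L₂
  ... | T₂ , forest₂ , T₂⊆ , spans₂ with greedy-forest (T₂ ++ F) forest₂ L₁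
  ... | T₁ , forest₁ , T₁⊆ , spans₁ = cancel bound₁ bound₂ bound∪ bound∩
    where
    t₁ t₂ f : ℕ
    t₁ = length T₁
    t₂ = length T₂
    f = length F
    cancel : (t₁ + f) + c₁ ≤ n → (t₂ + f) + c₂ ≤ n → n ≤ c∪ + (t₁ + (t₂ + f)) → n ≤ c∩ + f →
             c₁ + c₂ ≤ c∪ + c∩
    cancel h₁ h₂ h∪ h∩ = +-cancelʳ-≤ (t₁ + t₂ + f + f) (c₁ + c₂) (c∪ + c∩)
      (subst₂ _≤_ (sym (lhs c₁ c₂ t₁ t₂ f)) (rhs c∪ c∩ t₁ t₂ f) (≤-trans (+-mono-≤ h₁ h₂) (+-mono-≤ h∪ h∩)))
      where
      lhs : ∀ c₁ c₂ t₁ t₂ f → c₁ + c₂ + (t₁ + t₂ + f + f) ≡ (t₁ + f + c₁) + (t₂ + f + c₂)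
      lhs = solve-∀
      rhs : ∀ c∪ c∩ t₁ t₂ f → (c∪ + (t₁ + (t₂ + f))) + (c∩ + f) ≡ c∪ + c∩ + (t₁ + t₂ + f + f)
      rhs = solve-∀
    bound∩ : n ≤ c∩ + f
    bound∩ = n≤components+length F L∩ forestF spansF comp∩
    bound∪ : n ≤ c∪ + (t₁ + (t₂ + f))
    bound∪ = subst (λ k → n ≤ c∪ + k) (trans (length-++ T₁) (cong (t₁ +_) (length-++ T₂)))
               (n≤components+length (T₁ ++ T₂ ++ F) L∪ forest₁ spans∪ comp∪)
      where
      spans∪ : ∀ {z} → z ∈ₗ L∪ → Path (T₁ ++ T₂ ++ F) (eu z) (ev z)
      spans∪ z∈ with ∪⊆ z∈
      ... | inj₁ q = spans₁ q
      ... | inj₂ q = path-mono (∈-++⁺ʳ T₁) (spans₂ q)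
    bound₂ : (t₂ + f) + c₂ ≤ n
    bound₂ = forest-++-length+components≤n T₂ F forest₂ T₂⊆ (∩⊆₂ ∘ F⊆) comp₂
    bound₁ : (t₁ + f) + c₁ ≤ n
    bound₁ = forest-++-length+components≤n T₁ F (forest-⊑ (++⁺ (⊑-refl {x = T₁}) (++⁺ˡ T₂ (⊑-refl {x = F}))) forest₁)
               T₁⊆ (∩⊆₁ ∘ F⊆) comp₁

  add-if-independent : ∀ T → Forest T → (l : List X) → length l ≤ 1 →
                       Σ (List X) λ l′ → (l′ ≡ [] ⊎ l′ ≡ l) × Forest (l′ ++ T) ×
                       (∀ {z} → z ∈ₗ l → Path (l′ ++ T) (eu z) (ev z))
  add-if-independent T forest [] _ = [] , inj₁ refl , forest , λ ()
  add-if-independent T forest (x ∷ []) _ with path? T forest (eu x) (ev x)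
  ... | yes p = [] , inj₁ refl , forest , λ { (here refl) → p }
  ... | no ¬p = x ∷ [] , inj₂ refl , (¬p , forest) , λ { (here refl) → edge⇒path (here refl) }
  add-if-independent T forest (_ ∷ _ ∷ _) (s≤s ())

  greedy-selection : ∀ {k} (f : Fin k → List X) → (∀ i → length (f i) ≤ 1) →
                     Σ (Fin k → List X) λ ch → (∀ i → ch i ≡ [] ⊎ ch i ≡ f i) × Forest (concatFin ch) ×
                     (∀ {z} → z ∈ₗ concatFin f → Path (concatFin ch) (eu z) (ev z))
  greedy-selection {zero} f _ = (λ ()) , (λ ()) , tt , λ ()
  greedy-selection {suc k} f ≤1 with greedy-selection (f ∘ suc) (≤1 ∘ suc)
  ... | ch , ch≡ , forest , spans with add-if-independent (concatFin ch) forest (f zero) (≤1 zero)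
  ... | l , l≡ , forest′ , spans₀ = ch′ , ch′≡ , forest′ , spans′
    where
    ch′ : Fin (suc k) → List X
    ch′ zero = l
    ch′ (suc i) = ch i
    ch′≡ : ∀ i → ch′ i ≡ [] ⊎ ch′ i ≡ f i
    ch′≡ zero = l≡
    ch′≡ (suc i) = ch≡ i
    spans′ : ∀ {z} → z ∈ₗ concatFin f → Path (concatFin ch′) (eu z) (ev z)
    spans′ z∈ with ∈-++⁻ (f zero) z∈
    ... | inj₁ q = spans₀ q
    ... | inj₂ q = path-mono (∈-++⁺ʳ l) (spans q)

  forest-bridge : ∀ pre x post → Forest (pre ++ x ∷ post) → ¬ Path (pre ++ post) (eu x) (ev x)
  forest-bridge [] x post (x-joins , _) = x-joins
  forest-bridge (y ∷ pre) x post (y-joins , forest) p = bridge (path-∷⁻ y (pre ++ post) p)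
    where
    up : Path (pre ++ post) ⇒ Path (pre ++ x ∷ post)
    up = path-mono (∈-++-insert pre)
    x-path : Path (pre ++ x ∷ post) (eu x) (ev x)
    x-path = edge⇒path (∈-insert pre)
    bridge : Path (pre ++ post) (eu x) (ev x) ⊎ (Path (pre ++ post) (eu x) (eu y) × Path (pre ++ post) (ev y) (ev x))
             ⊎ (Path (pre ++ post) (eu x) (ev y) × Path (pre ++ post) (eu y) (ev x)) → ⊥
    bridge (inj₁ q) = forest-bridge pre x post forest q
    bridge (inj₂ (inj₁ (q , r))) = y-joins (up (path-sym q) ◅◅ x-path ◅◅ up (path-sym r))
    bridge (inj₂ (inj₂ (q , r))) = y-joins (up r ◅◅ path-sym x-path ◅◅ up q)

  suffix-acyclic⇒forest : ∀ L → (∀ pre x post → L ≡ pre ++ x ∷ post → ¬ Path post (eu x) (ev x)) → Forest L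
  suffix-acyclic⇒forest [] _ = tt
  suffix-acyclic⇒forest (x ∷ L) h =
    h [] x L refl , suffix-acyclic⇒forest L (λ pre y post eq → h (x ∷ pre) y post (cong (x ∷_) eq))

Distinct : ∀ {A : Set} → List A → Set
Distinct [] = ⊤
Distinct (x ∷ l) = ¬ x ∈ₗ l × Distinct l

distinct-++⁻ʳ : ∀ {A : Set} (ys : List A) {zs} → Distinct (ys ++ zs) → Distinct zs
distinct-++⁻ʳ [] d = d
distinct-++⁻ʳ (y ∷ ys) (_ , d) = distinct-++⁻ʳ ys d

distinct⇒lookup-injective : ∀ {A : Set} (l : List A) → Distinct l → ∀ i j → L.lookup l i ≡ L.lookup l j → i ≡ j
distinct⇒lookup-injective (x ∷ l) _ zero zero _ = refl
distinct⇒lookup-injective (x ∷ l) (x∉ , _) zero (suc j) eq = ⊥-elim (x∉ (subst (_∈ₗ l) (sym eq) (∈-lookup j)))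
distinct⇒lookup-injective (x ∷ l) (x∉ , _) (suc i) zero eq = ⊥-elim (x∉ (subst (_∈ₗ l) eq (∈-lookup i)))
distinct⇒lookup-injective (x ∷ l) (_ , d) (suc i) (suc j) eq = cong suc (distinct⇒lookup-injective l d i j eq)

-- A step i of a sequence and a step j traversed backwards cannot have the
-- same ends: that would force toℕ j = toℕ i + 1 and toℕ i = toℕ j + 1.
adjacent-pairs-injective : ∀ {A : Set} {k} (w : Fin (suc k) → A) → (∀ i j → w i ≡ w j → i ≡ j) →
  ∀ (i j : Fin k) {a b} → (a ≡ w (inject₁ i) × b ≡ w (suc i)) ⊎ (a ≡ w (suc i) × b ≡ w (inject₁ i)) →
  (a ≡ w (inject₁ j) × b ≡ w (suc j)) ⊎ (a ≡ w (suc j) × b ≡ w (inject₁ j)) → i ≡ j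
adjacent-pairs-injective w w-inj i j (inj₁ (p , _)) (inj₁ (p′ , _)) = FP.inject₁-injective (w-inj _ _ (trans (sym p) p′))
adjacent-pairs-injective w w-inj i j (inj₂ (p , _)) (inj₂ (p′ , _)) = FP.suc-injective (w-inj _ _ (trans (sym p) p′))
adjacent-pairs-injective w w-inj i j (inj₁ (p , q)) (inj₂ (p′ , q′)) =
  ⊥-elim (crossed i j (w-inj _ _ (trans (sym p) p′)) (w-inj _ _ (trans (sym q) q′)))
  where
  crossed : ∀ {k} (i j : Fin k) → inject₁ i ≡ suc j → suc i ≡ inject₁ j → ⊥
  crossed i j i≡j+1 i+1≡j = m≢1+n+m (F.toℕ j) (sym (begin
    suc (suc (F.toℕ j))        ≡⟨ cong suc (trans (sym (cong F.toℕ i≡j+1)) (FP.toℕ-inject₁ i)) ⟩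
    suc (F.toℕ i)              ≡⟨ trans (cong F.toℕ i+1≡j) (FP.toℕ-inject₁ j) ⟩
    F.toℕ j                    ∎))
    where open ≡-Reasoning
adjacent-pairs-injective w w-inj i j (inj₂ r) (inj₁ r′) = sym (adjacent-pairs-injective w w-inj j i (inj₁ r′) (inj₂ r))

distinct-labels : ∀ {X : Set} {k l} (label : X → Fin l) (f : Fin k → List X) (g : Fin k → Fin l) →
                  (∀ i j → g i ≡ g j → i ≡ j) → (∀ i {z} → z ∈ₗ f i → label z ≡ g i) → (∀ i → length (f i) ≤ 1) →
                  Distinct (map label (concatFin f))
distinct-labels {k = zero} label f g g-inj labelled ≤1 = tt
distinct-labels {k = suc k} label f g g-inj labelled ≤1 =
  subst Distinct (sym (map-++ label (f zero) (concatFin (f ∘ suc)))) (head (f zero) refl (≤1 zero))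
  where
  tail : Distinct (map label (concatFin (f ∘ suc)))
  tail = distinct-labels label (f ∘ suc) (g ∘ suc) (λ i j eq → FP.suc-injective (g-inj (suc i) (suc j) eq))
           (labelled ∘ suc) (≤1 ∘ suc)
  head : (l : List _) → f zero ≡ l → length l ≤ 1 → Distinct (map label l ++ map label (concatFin (f ∘ suc)))
  head [] _ _ = tail
  head (z ∷ []) f₀≡ _ = fresh , tail
    where
    fresh : ¬ label z ∈ₗ map label (concatFin (f ∘ suc))
    fresh z∈ with ∈-map⁻ label z∈
    ... | y , y∈ , eq with ∈-concatFin⁻ (f ∘ suc) y∈
    ... | i , y∈i = FP.0≢1+n (g-inj zero (suc i)
          (trans (sym (labelled zero (subst (z ∈ₗ_) (sym f₀≡) (here refl)))) (trans eq (labelled (suc i) y∈i))))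
  head (_ ∷ _ ∷ _) _ (s≤s ())

consecutive⇒star : ∀ {A : Set} {R : A → A → Set} {k} (w : Fin (suc k) → A) →
                   (∀ (i : Fin k) → R (w (inject₁ i)) (w (suc i))) → ∀ i → Star R (w zero) (w i)
consecutive⇒star {k = zero} w steps zero = ε
consecutive⇒star {k = suc k} w steps zero = ε
consecutive⇒star {k = suc k} w steps (suc i) = steps zero ◅ consecutive⇒star (w ∘ suc) (steps ∘ suc) i

module SimplePaths {n : ℕ} (R : Fin n → Fin n → Set) where
  open import Data.List.Membership.DecPropositional (F._≟_ {n}) using () renaming (_∈?_ to _∈ₗ?_)

  Chain : List (Fin n) → Set
  Chain [] = ⊤
  Chain (x ∷ []) = ⊤
  Chain (x ∷ y ∷ l) = R x y × Chain (y ∷ l)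

  Last : List (Fin n) → Fin n → Set
  Last [] a = ⊥
  Last (x ∷ []) a = x ≡ a
  Last (x ∷ y ∷ l) a = Last (y ∷ l) a

  chain-++⁻ʳ : ∀ ys {b zs} → Chain (ys ++ b ∷ zs) → Chain (b ∷ zs)
  chain-++⁻ʳ [] c = c
  chain-++⁻ʳ (y ∷ []) (_ , c) = c
  chain-++⁻ʳ (y ∷ y′ ∷ ys) (_ , c) = chain-++⁻ʳ (y′ ∷ ys) c

  last-++⁻ʳ : ∀ ys {b zs a} → Last (ys ++ b ∷ zs) a → Last (b ∷ zs) a
  last-++⁻ʳ [] l = l
  last-++⁻ʳ (y ∷ []) l = l
  last-++⁻ʳ (y ∷ y′ ∷ ys) l = last-++⁻ʳ (y′ ∷ ys) l

  SimplePath : Fin n → Fin n → Set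
  SimplePath b a = Σ (List (Fin n)) λ rest → Distinct (b ∷ rest) × Chain (b ∷ rest) × Last (b ∷ rest) a

  -- On revisiting b, the loop back to b is cut off.
  erase-loops : ∀ {b a} → Star R b a → SimplePath b a
  erase-loops ε = [] , ((λ ()) , tt) , tt , refl
  erase-loops {b} {a} (_◅_ {j = c} r p) with erase-loops p
  ... | rest , distinct , chain , last with b ∈ₗ? (c ∷ rest)
  ... | no b∉ = c ∷ rest , (b∉ , distinct) , (r , chain) , last
  ... | yes b∈ with ∈-∃++ b∈
  ... | ys , zs , eq = zs , distinct-++⁻ʳ ys (subst Distinct eq distinct) ,
                       chain-++⁻ʳ ys (subst Chain eq chain) , last-++⁻ʳ ys (subst (λ l → Last l a) eq last)

  chain-lookup : ∀ b rest → Chain (b ∷ rest) → ∀ (i : Fin (length rest)) →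
                 R (L.lookup (b ∷ rest) (inject₁ i)) (L.lookup (b ∷ rest) (suc i))
  chain-lookup b (c ∷ rest) (r , _) zero = r
  chain-lookup b (c ∷ rest) (_ , chain) (suc i) = chain-lookup c rest chain i

  last-lookup : ∀ b rest {a} → Last (b ∷ rest) a → L.lookup (b ∷ rest) (fromℕ (length rest)) ≡ a
  last-lookup b [] last = last
  last-lookup b (c ∷ rest) last = last-lookup c rest last

module HedgeSystems (G : Hedgegraph) where

  TrimmedHedge : Set
  TrimmedHedge = Σ (Fin (m G)) (Trim G)

  label : TrimmedHedge → Fin (m G)
  label = proj₁

  ends₁ ends₂ : TrimmedHedge → Fin (n G)
  ends₁ (_ , t) = u t
  ends₂ (_ , t) = v t

  open Multigraph ends₁ ends₂ public

  Candidates : Set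
  Candidates = (e : Fin (m G)) → List (Trim G e)

  tagged : (e : Fin (m G)) → List (Trim G e) → List TrimmedHedge
  tagged e = map (e ,_)

  keepIn keepOut : Subset (m G) → (Fin (m G) → List TrimmedHedge) → Fin (m G) → List TrimmedHedge
  keepIn B f e with e ∈? B
  ... | yes _ = f e
  ... | no _ = []
  keepOut B f e with e ∈? B
  ... | yes _ = []
  ... | no _ = f e

  edgesOf : Candidates → Subset (m G) → List TrimmedHedge
  edgesOf P B = concatFin (keepIn B λ e → tagged e (P e))

  ∈-edgesOf⁻ : ∀ P B {z} → z ∈ₗ edgesOf P B → label z ∈ B × proj₂ z ∈ₗ P (label z)
  ∈-edgesOf⁻ P B z∈ with ∈-concatFin⁻ (keepIn B λ e → tagged e (P e)) z∈
  ... | e , z∈e with e ∈? B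
  ... | yes e∈ with ∈-map⁻ (e ,_) z∈e
  ... | t , t∈ , refl = e∈ , t∈
  ∈-edgesOf⁻ P B z∈ | e , () | no _

  ∈-edgesOf⁺ : ∀ P B {e t} → e ∈ B → t ∈ₗ P e → (e , t) ∈ₗ edgesOf P B
  ∈-edgesOf⁺ P B {e} {t} e∈ t∈ = ∈-concatFin⁺ _ e kept
    where
    kept : (e , t) ∈ₗ keepIn B (λ e → tagged e (P e)) e
    kept with e ∈? B
    ... | yes _ = ∈-map⁺ (e ,_) t∈
    ... | no e∉ = ⊥-elim (e∉ e∈)

  -- Trimmings carry proofs (of u ≢ v) that are not comparable, so a
  -- trimming is matched against the candidates by its ends only.
  HasCandidate : Candidates → ∀ {e} → Trim G e → Set
  HasCandidate P {e} t = Σ (Trim G e) λ t′ → t′ ∈ₗ P e × u t′ ≡ u t × v t′ ≡ v t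

  Selection : Candidates → Subset (m G) → (Fin (m G) → List TrimmedHedge) → Set
  Selection P A ch = ∀ e → ch e ≡ [] ⊎ Σ (Trim G e) λ t → ch e ≡ (e , t) ∷ [] × e ∈ A × HasCandidate P t

  selection-length≤1 : ∀ {P A ch} → Selection P A ch → ∀ e → length (ch e) ≤ 1
  selection-length≤1 sel e with sel e
  ... | inj₁ eq rewrite eq = z≤n
  ... | inj₂ (t , eq , _) rewrite eq = s≤s z≤n

  selection-mono : ∀ {P Q A} → (∀ e {t} → t ∈ₗ Q e → t ∈ₗ P e) → ∀ {ch} → Selection Q A ch → Selection P A ch
  selection-mono Q⊆P sel e with sel e
  ... | inj₁ eq = inj₁ eq
  ... | inj₂ (t , eq , e∈ , t′ , t′∈ , same-u , same-v) = inj₂ (t , eq , e∈ , t′ , Q⊆P e t′∈ , same-u , same-v)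

  selected⇒path : ∀ {P A ch} → Selection P A ch → ∀ B {z} → z ∈ₗ concatFin (keepIn B ch) →
                  Path (edgesOf P B) (ends₁ z) (ends₂ z)
  selected⇒path {ch = ch} sel B z∈ with ∈-concatFin⁻ (keepIn B ch) z∈
  ... | e , z∈e with e ∈? B
  ... | no _ = ⊥-elim (∉[] z∈e)
  ... | yes e∈ with sel e
  ... | inj₁ eq = ⊥-elim (∉[] (subst (_ ∈ₗ_) eq z∈e))
  ... | inj₂ (t , eq , _ , t′ , t′∈ , same-u , same-v) with subst (_ ∈ₗ_) eq z∈e
  ... | here refl = ((e , t′) , ∈-edgesOf⁺ _ B e∈ t′∈ , inj₁ (same-u , same-v)) ◅ ε

  -- Hedges of B contribute at most f(B) forest edges, the others at most one each.
  selection-bound : ∀ P A ch → Selection P A ch → Forest (concatFin ch) → ∀ B {c} →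
                    Components (Edge (edgesOf P B)) c → length (concatFin ch) + c ≤ n G + ∣ A ─ B ∣
  selection-bound P A ch sel forest B {c} compB = begin
    length (concatFin ch) + c
      ≡⟨ cong (_+ c) (length-concatFin-split ch (keepIn B ch) (keepOut B ch) split) ⟩
    length (concatFin (keepIn B ch)) + length (concatFin (keepOut B ch)) + c
      ≡⟨ +-xy∙z≈xz∙y (length (concatFin (keepIn B ch))) _ c ⟩
    length (concatFin (keepIn B ch)) + c + length (concatFin (keepOut B ch))
      ≤⟨ +-mono-≤ inB outB ⟩
    n G + ∣ A ─ B ∣ ∎
    where
    open ≤-Reasoning
    split : ∀ e → length (ch e) ≡ length (keepIn B ch e) + length (keepOut B ch e)
    split e with e ∈? B
    ... | yes _ = sym (+-identityʳ _)
    ... | no _ = refl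
    keepIn-⊑ : ∀ e → keepIn B ch e ⊑ ch e
    keepIn-⊑ e with e ∈? B
    ... | yes _ = ⊑-refl
    ... | no _ = Sublist.minimum _
    inB : length (concatFin (keepIn B ch)) + c ≤ n G
    inB = forest-length+components≤n _ edge-sym (forest-⊑ (concatFin-⊑ _ ch keepIn-⊑) forest)
            (selected⇒path sel B) compB
    outB : length (concatFin (keepOut B ch)) ≤ ∣ A ─ B ∣
    outB = length-concatFin≤ (keepOut B ch) (A ─ B) ≤1 empty-off-A─B
      where
      ≤1 : ∀ e → length (keepOut B ch e) ≤ 1
      ≤1 e with e ∈? B
      ... | yes _ = z≤n
      ... | no _ = selection-length≤1 sel e
      empty-off-A─B : ∀ e → e ∉ A ─ B → keepOut B ch e ≡ []
      empty-off-A─B e e∉ with e ∈? B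
      ... | yes _ = refl
      ... | no e∉B with sel e
      ... | inj₁ eq = eq
      ... | inj₂ (_ , _ , e∈A , _) = ⊥-elim (e∉ (x∈p∧x∉q⇒x∈p─q e∈A e∉B))

  -- tight says |choice| ≥ f(cut) + |A ∖ cut|, with f(cut) = n − components.
  record RadoWitness (P : Candidates) (A : Subset (m G)) : Set where
    field
      choice : Fin (m G) → List TrimmedHedge
      selection : Selection P A choice
      forest : Forest (concatFin choice)
      cut : Subset (m G)
      cut⊆A : cut ⊆ A
      components : ℕ
      cut-components : Components (Edge (edgesOf P cut)) components
      tight : n G + ∣ A ─ cut ∣ ≤ length (concatFin choice) + components

  singleton-selection : ∀ P A e (l : List (Trim G e)) → length l ≤ 1 → (∀ {t} → t ∈ₗ l → t ∈ₗ P e) → e ∈ A →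
    ∀ {c₀} → c₀ ≡ tagged e l → c₀ ≡ [] ⊎ Σ (Trim G e) λ t → c₀ ≡ (e , t) ∷ [] × e ∈ A × HasCandidate P t
  singleton-selection P A e [] _ _ _ c₀≡ = inj₁ c₀≡
  singleton-selection P A e (t ∷ []) _ l⊆P e∈ c₀≡ = inj₂ (t , c₀≡ , e∈ , t , l⊆P (here refl) , refl , refl)
  singleton-selection P A e (_ ∷ _ ∷ _) (s≤s ()) _ _ _

  rado-base : ∀ P A → (∀ e → e ∈ A → length (P e) ≤ 1) → RadoWitness P A
  rado-base P A ≤1 with greedy-selection (keepIn A λ e → tagged e (P e)) ≤1-in-A
    where
    ≤1-in-A : ∀ e → length (keepIn A (λ e → tagged e (P e)) e) ≤ 1
    ≤1-in-A e with e ∈? A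
    ... | yes e∈ = subst (_≤ 1) (sym (length-map (_,_ {B = Trim G} e) (P e))) (≤1 e e∈)
    ... | no _ = z≤n
  ... | ch , ch≡ , forest , spans with forest-components (concatFin ch) forest
  ... | c , compCh , c+∣ch∣ = record
    { choice = ch
    ; selection = selection
    ; forest = forest
    ; cut = A
    ; cut⊆A = id
    ; components = c
    ; cut-components = components-resp (path-mono ch⊆edges) (path-lift edge-sym spans) compCh
    ; tight = ≤-reflexive exact
    }
    where
    exact : n G + ∣ A ─ A ∣ ≡ length (concatFin ch) + c
    exact = begin
      n G + ∣ A ─ A ∣              ≡⟨ cong (n G +_) (∣p─p∣≡0 A) ⟩
      n G + 0                      ≡⟨ +-identityʳ (n G) ⟩
      n G                          ≡⟨ sym c+∣ch∣ ⟩
      c + length (concatFin ch)    ≡⟨ +-comm c _ ⟩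
      length (concatFin ch) + c    ∎
      where open ≡-Reasoning
    selection : Selection P A ch
    selection e with ch≡ e
    ... | inj₁ eq = inj₁ eq
    ... | inj₂ eq with e ∈? A
    ... | yes e∈ = singleton-selection P A e (P e) (≤1 e e∈) id e∈ eq
    ... | no _ = inj₁ eq
    ch⊆edges : ∀ {z} → z ∈ₗ concatFin ch → z ∈ₗ edgesOf P A
    ch⊆edges z∈ with ∈-concatFin⁻ ch z∈
    ... | e , z∈e with ch≡ e
    ... | inj₁ eq = ⊥-elim (∉[] (subst (_ ∈ₗ_) eq z∈e))
    ... | inj₂ eq = ∈-concatFin⁺ _ e (subst (_ ∈ₗ_) eq z∈e)

  update : Candidates → (e : Fin (m G)) → List (Trim G e) → Candidates
  update P e l e′ with e′ F.≟ e
  ... | yes refl = l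
  ... | no _ = P e′

  update-≢ : ∀ P e l e′ → e′ ≢ e → update P e l e′ ≡ P e′
  update-≢ P e l e′ e′≢e with e′ F.≟ e
  ... | yes refl = ⊥-elim (e′≢e refl)
  ... | no _ = refl

  update-≡ : ∀ P e l → update P e l e ≡ l
  update-≡ P e l with e F.≟ e
  ... | yes refl = refl
  ... | no e≢e = ⊥-elim (e≢e refl)

  weight : Candidates → ℕ
  weight P = sumFin (λ e → length (P e))

  weight-update-< : ∀ P e l → length l < length (P e) → weight (update P e l) < weight P
  weight-update-< P e l shorter =
    sumFin-mono-< _ _ shrinks e (subst (_< length (P e)) (sym (cong length (update-≡ P e l))) shorter)
    where
    shrinks : ∀ e′ → length (update P e l e′) ≤ length (P e′)
    shrinks e′ with e′ F.≟ e
    ... | yes refl = <⇒≤ shorter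
    ... | no _ = ≤-refl

  edgesOf-agree : ∀ P Q e → (∀ e′ → e′ ≢ e → Q e′ ≡ P e′) → ∀ {B B′} → B ⊆ B′ →
                  ∀ {z} → z ∈ₗ edgesOf P (B - e) → z ∈ₗ edgesOf Q B′
  edgesOf-agree P Q e Q≗P B⊆B′ {e′ , t} z∈ with ∈-edgesOf⁻ P _ z∈
  ... | e′∈B-e , t∈ with x∈p-y⁻ e′∈B-e
  ... | e′∈B , e′≢e = ∈-edgesOf⁺ Q _ (B⊆B′ e′∈B) (subst (t ∈ₗ_) (sym (Q≗P e′ e′≢e)) t∈)

  module RadoStep (P : Candidates) (A : Subset (m G)) {e : Fin (m G)} (e∈A : e ∈ A)
                  (t₁ t₂ : Trim G e) (rest : List (Trim G e)) (P≡ : P e ≡ t₁ ∷ t₂ ∷ rest) where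

    P₋₁ P₋₂ : Candidates
    P₋₁ = update P e (t₂ ∷ rest)
    P₋₂ = update P e (t₁ ∷ rest)

    P₋₁⊆P : ∀ e′ {t} → t ∈ₗ P₋₁ e′ → t ∈ₗ P e′
    P₋₁⊆P e′ t∈ with e′ F.≟ e
    ... | yes refl rewrite P≡ = there t∈
    ... | no _ = t∈

    P₋₂⊆P : ∀ e′ {t} → t ∈ₗ P₋₂ e′ → t ∈ₗ P e′
    P₋₂⊆P e′ t∈ with e′ F.≟ e
    ... | yes refl rewrite P≡ with t∈
    ... | here t≡t₁ = here t≡t₁
    ... | there t∈rest = there (there t∈rest)
    P₋₂⊆P e′ t∈ | no _ = t∈

    weight-P₋₁ : weight P₋₁ < weight P
    weight-P₋₁ = weight-update-< P e (t₂ ∷ rest) (subst (λ l → length (t₂ ∷ rest) < length l) (sym P≡) ≤-refl)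

    weight-P₋₂ : weight P₋₂ < weight P
    weight-P₋₂ = weight-update-< P e (t₁ ∷ rest) (subst (λ l → length (t₁ ∷ rest) < length l) (sym P≡) ≤-refl)

    transfer : ∀ {Q} → (∀ e′ {t} → t ∈ₗ Q e′ → t ∈ₗ P e′) → (∀ e′ → e′ ≢ e → Q e′ ≡ P e′) →
               (W : RadoWitness Q A) → e ∉ RadoWitness.cut W → RadoWitness P A
    transfer {Q} Q⊆P Q≗P W e∉ = record
      { choice = choice ; selection = selection-mono Q⊆P selection ; forest = forest
      ; cut = cut ; cut⊆A = cut⊆A ; components = components
      ; cut-components = subst (λ L → Components (Edge L) components) (concatFin-cong _ _ agree) cut-components
      ; tight = tight }
      where
      open RadoWitness W
      agree : ∀ e′ → keepIn cut (λ e → tagged e (Q e)) e′ ≡ keepIn cut (λ e → tagged e (P e)) e′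
      agree e′ with e′ ∈? cut
      ... | yes e′∈ = cong (tagged e′) (Q≗P e′ λ { refl → e∉ e′∈ })
      ... | no _ = refl

    module Uncross (W₁ : RadoWitness P₋₁ A) (W₂ : RadoWitness P₋₂ A)
                   (e∈B₁ : e ∈ RadoWitness.cut W₁) (e∈B₂ : e ∈ RadoWitness.cut W₂) where
      module W₁ = RadoWitness W₁
      module W₂ = RadoWitness W₂

      B₁ B₂ B∪ B∩ : Subset (m G)
      B₁ = W₁.cut
      B₂ = W₂.cut
      B∪ = B₁ ∪ B₂
      B∩ = (B₁ ∩ B₂) - e

      c∪ c∩ ℓ₁ ℓ₂ : ℕ
      c∪ = proj₁ (components-exist (edgesOf P B∪))
      c∩ = proj₁ (components-exist (edgesOf P B∩))
      ℓ₁ = length (concatFin W₁.choice)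
      ℓ₂ = length (concatFin W₂.choice)

      edges∪ : ∀ {z} → z ∈ₗ edgesOf P B∪ → z ∈ₗ edgesOf P₋₁ B₁ ⊎ z ∈ₗ edgesOf P₋₂ B₂

      edges∪ {e′ , t} z∈ with ∈-edgesOf⁻ P B∪ z∈
      ... | e′∈ , t∈ with e′ F.≟ e
      ... | yes refl with subst (t ∈ₗ_) P≡ t∈
      ... | here t≡t₁ = inj₂ (∈-edgesOf⁺ P₋₂ B₂ e∈B₂ (subst (t ∈ₗ_) (sym (update-≡ P e _)) (here t≡t₁)))
      ... | there t∈′ = inj₁ (∈-edgesOf⁺ P₋₁ B₁ e∈B₁ (subst (t ∈ₗ_) (sym (update-≡ P e _)) t∈′))

      edges∪ {e′ , t} z∈ | e′∈ , t∈ | no e′≢e with x∈p∪q⁻ B₁ B₂ e′∈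
      ... | inj₁ q = inj₁ (∈-edgesOf⁺ P₋₁ B₁ q (subst (t ∈ₗ_) (sym (update-≢ P e _ e′ e′≢e)) t∈))
      ... | inj₂ q = inj₂ (∈-edgesOf⁺ P₋₂ B₂ q (subst (t ∈ₗ_) (sym (update-≢ P e _ e′ e′≢e)) t∈))

      submodular : W₁.components + W₂.components ≤ c∪ + c∩

      submodular = components-submodular _ _ _ _ edges∪
        (edgesOf-agree P P₋₁ e (update-≢ P e _) (SP.p∩q⊆p B₁ B₂))
        (edgesOf-agree P P₋₂ e (update-≢ P e _) (SP.p∩q⊆q B₁ B₂))
        W₁.cut-components W₂.cut-components
        (proj₂ (components-exist (edgesOf P B∪))) (proj₂ (components-exist (edgesOf P B∩)))

      -- |A ─ B₁| + |A ─ B₂| = |A ─ B∪| + |A ─ B∩| − 1, as e ∈ B₁ ∩ B₂ lies outside B∩.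
      sum-bound : (n G + ∣ A ─ B∪ ∣) + (n G + ∣ A ─ B∩ ∣) ≤ suc ((ℓ₁ + c∪) + (ℓ₂ + c∩))
      sum-bound = begin
        (n G + ∣ A ─ B∪ ∣) + (n G + ∣ A ─ B∩ ∣)
          ≡⟨ cong (λ k → (n G + ∣ A ─ B∪ ∣) + (n G + k)) (∣p─[q-x]∣≡1+∣p─q∣ A (B₁ ∩ B₂) e∈A (x∈p∩q⁺ (e∈B₁ , e∈B₂))) ⟩
        (n G + ∣ A ─ B∪ ∣) + (n G + suc ∣ A ─ (B₁ ∩ B₂) ∣)
          ≡⟨ shuffle (n G) ∣ A ─ B∪ ∣ ∣ A ─ (B₁ ∩ B₂) ∣ ⟩
        suc (n G + n G + (∣ A ─ B∪ ∣ + ∣ A ─ (B₁ ∩ B₂) ∣))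
          ≡⟨ cong (λ k → suc (n G + n G + k)) (sym (∣p─q∣+∣p─r∣≡∣p─q∪r∣+∣p─q∩r∣ A B₁ B₂)) ⟩
        suc (n G + n G + (∣ A ─ B₁ ∣ + ∣ A ─ B₂ ∣))
          ≡⟨ cong suc (+-interchange (n G) (n G) ∣ A ─ B₁ ∣ ∣ A ─ B₂ ∣) ⟩
        suc ((n G + ∣ A ─ B₁ ∣) + (n G + ∣ A ─ B₂ ∣))
          ≤⟨ s≤s (+-mono-≤ W₁.tight W₂.tight) ⟩
        suc ((ℓ₁ + W₁.components) + (ℓ₂ + W₂.components))
          ≡⟨ cong suc (+-interchange ℓ₁ W₁.components ℓ₂ W₂.components) ⟩
        suc ((ℓ₁ + ℓ₂) + (W₁.components + W₂.components))
          ≤⟨ s≤s (+-monoʳ-≤ (ℓ₁ + ℓ₂) submodular) ⟩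
        suc ((ℓ₁ + ℓ₂) + (c∪ + c∩))
          ≡⟨ cong suc (+-interchange ℓ₁ ℓ₂ c∪ c∩) ⟩
        suc ((ℓ₁ + c∪) + (ℓ₂ + c∩)) ∎
        where
        open ≤-Reasoning
        shuffle : ∀ n a b → (n + a) + (n + suc b) ≡ suc (n + n + (a + b))
        shuffle = solve-∀

      choose : n G + ∣ A ─ B∪ ∣ ≤ ℓ₁ + c∪ ⊎ n G + ∣ A ─ B∩ ∣ ≤ ℓ₂ + c∩ → RadoWitness P A

      choose (inj₁ tight∪) = record
        { choice = W₁.choice ; selection = selection-mono P₋₁⊆P W₁.selection ; forest = W₁.forest
        ; cut = B∪ ; cut⊆A = [ W₁.cut⊆A , W₂.cut⊆A ] ∘ x∈p∪q⁻ B₁ B₂ ; components = c∪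
        ; cut-components = proj₂ (components-exist (edgesOf P B∪)) ; tight = tight∪ }

      choose (inj₂ tight∩) = record
        { choice = W₂.choice ; selection = selection-mono P₋₂⊆P W₂.selection ; forest = W₂.forest
        ; cut = B∩ ; cut⊆A = W₁.cut⊆A ∘ SP.p∩q⊆p B₁ B₂ ∘ proj₁ ∘ x∈p-y⁻ ; components = c∩
        ; cut-components = proj₂ (components-exist (edgesOf P B∩)) ; tight = tight∩ }

      uncross : RadoWitness P A

      uncross = choose (≤-split _ _ _ _ sum-bound)

    rado-step : RadoWitness P₋₁ A → RadoWitness P₋₂ A → RadoWitness P A
    rado-step W₁ W₂ with e ∈? RadoWitness.cut W₁ | e ∈? RadoWitness.cut W₂
    ... | no e∉B₁ | _ = transfer P₋₁⊆P (update-≢ P e _) W₁ e∉B₁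
    ... | yes _ | no e∉B₂ = transfer P₋₂⊆P (update-≢ P e _) W₂ e∉B₂
    ... | yes e∈B₁ | yes e∈B₂ = Uncross.uncross W₁ W₂ e∈B₁ e∈B₂

  rado : ∀ A P → RadoWitness P A
  rado A = All.wfRec (On.wellFounded weight <-wellFounded) _ (λ P → RadoWitness P A) step
    where
    step : ∀ P → (∀ {Q} → weight Q < weight P → RadoWitness Q A) → RadoWitness P A
    step P rec with any? (λ e → (e ∈? A) ×-dec (2 ≤? length (P e)))
    ... | no none = rado-base P A (λ e e∈ → s≤s⁻¹ (≰⇒> (λ 2≤ → none (e , e∈ , 2≤))))
    ... | yes (e , e∈A , 2≤) = split (P e) refl 2≤
      where
      split : (l : List (Trim G e)) → P e ≡ l → 2 ≤ length l → RadoWitness P A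
      split (_ ∷ []) _ (s≤s ())
      split (t₁ ∷ t₂ ∷ rest) P≡ _ = rado-step (rec weight-P₋₁) (rec weight-P₋₂)
        where open RadoStep P A e∈A t₁ t₂ rest P≡

module HedgegraphTrimmings (G : Hedgegraph) where
  open HedgeSystems G

  trimsAt : (e : Fin (m G)) (j : Fin (size G e)) (a b : Fin (n G)) → List (Trim G e)
  trimsAt e j a b with a ∈? hyp G e j | b ∈? hyp G e j | a F.≟ b
  ... | yes a∈ | yes b∈ | no a≢b = record { hedgeIx = j ; u = a ; v = b ; u≢v = a≢b ; u∈h = a∈ ; v∈h = b∈ } ∷ []
  ... | _ | _ | _ = []

  allTrims : Candidates
  allTrims e = concatFin λ j → concatFin λ a → concatFin λ b → trimsAt e j a b

  trimsAt-complete : ∀ e j a b → a ∈ hyp G e j → b ∈ hyp G e j → a ≢ b →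
                     Σ (Trim G e) λ t → t ∈ₗ trimsAt e j a b × u t ≡ a × v t ≡ b
  trimsAt-complete e j a b a∈ b∈ a≢b with a ∈? hyp G e j | b ∈? hyp G e j | a F.≟ b
  ... | yes _ | yes _ | no _ = _ , here refl , refl , refl
  ... | no a∉ | _ | _ = ⊥-elim (a∉ a∈)
  ... | yes _ | no b∉ | _ = ⊥-elim (b∉ b∈)
  ... | yes _ | yes _ | yes a≡b = ⊥-elim (a≢b a≡b)

  allTrims-complete : ∀ e j a b → a ∈ hyp G e j → b ∈ hyp G e j → a ≢ b →
                      Σ (Trim G e) λ t → t ∈ₗ allTrims e × u t ≡ a × v t ≡ b
  allTrims-complete e j a b a∈ b∈ a≢b with trimsAt-complete e j a b a∈ b∈ a≢b
  ... | t , t∈ , t-u , t-v = t , ∈-concatFin⁺ _ j (∈-concatFin⁺ _ a (∈-concatFin⁺ _ b t∈)) , t-u , t-v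

  hasCandidate : ∀ {e} (t : Trim G e) → HasCandidate allTrims t
  hasCandidate t = allTrims-complete _ (hedgeIx t) (u t) (v t) (u∈h t) (v∈h t) (u≢v t)

  conn⇒path : ∀ B → Conn G B ⇒ Path (edgesOf allTrims B)
  conn⇒path B = step ⋆
    where
    step : Adj G B ⇒ Path (edgesOf allTrims B)
    step {a} {b} (e , e∈ , j , a∈ , b∈) with a F.≟ b
    ... | yes refl = ε
    ... | no a≢b with allTrims-complete e j a b a∈ b∈ a≢b
    ... | t , t∈ , t-u , t-v = ((e , t) , ∈-edgesOf⁺ allTrims B e∈ t∈ , inj₁ (t-u , t-v)) ◅ ε

  path⇒conn : ∀ B → Path (edgesOf allTrims B) ⇒ Conn G B
  path⇒conn B = step ⋆
    where
    step : Edge (edgesOf allTrims B) ⇒ Conn G B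
    step ((e , t) , z∈ , inj₁ (refl , refl)) = (e , proj₁ (∈-edgesOf⁻ allTrims B z∈) , hedgeIx t , u∈h t , v∈h t) ◅ ε
    step ((e , t) , z∈ , inj₂ (refl , refl)) = (e , proj₁ (∈-edgesOf⁻ allTrims B z∈) , hedgeIx t , v∈h t , u∈h t) ◅ ε

  numComps⇒components : ∀ B {c} → NumComps G B c → Components (Edge (edgesOf allTrims B)) c
  numComps⇒components B = components-resp (conn⇒path B) (path⇒conn B)

  components⇒numComps : ∀ B {c} → Components (Edge (edgesOf allTrims B)) c → NumComps G B c
  components⇒numComps B = components-resp (path⇒conn B) (conn⇒path B)

  module FromSelection {P A} {ch : Fin (m G) → List TrimmedHedge} (sel : Selection P A ch)
                       (forest : Forest (concatFin ch)) where

    support : Subset (m G)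
    support = V.tabulate (λ e → not (L.null (ch e)))

    selected : ∀ {e} → e ∈ support → Σ (Trim G e) λ t → ch e ≡ (e , t) ∷ [] × e ∈ A
    selected {e} e∈ with sel e | trans (sym (lookup∘tabulate _ e)) ([]=⇒lookup e∈)
    ... | inj₂ (t , eq , e∈A , _) | _ = t , eq , e∈A
    ... | inj₁ eq | nonempty with subst (λ l → not (L.null l) ≡ true) eq nonempty
    ... | ()

    unselected : ∀ e → e ∉ support → ch e ≡ []
    unselected e e∉ with sel e
    ... | inj₁ eq = eq
    ... | inj₂ (t , eq , _) = ⊥-elim (e∉ (lookup⇒[]= e _ (trans (lookup∘tabulate _ e) (cong (not ∘ L.null) eq))))

    trim : Trimming G support
    trim e e∈ = proj₁ (selected e∈)

    support⊆A : support ⊆ A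
    support⊆A e∈ = proj₂ (proj₂ (selected e∈))

    ∣support∣ : ∣ support ∣ ≡ length (concatFin ch)
    ∣support∣ = sym (length-concatFin≡ ch support (λ e e∈ → cong length (proj₁ (proj₂ (selected e∈)))) unselected)

    trimmed∈ : ∀ e (e∈ : e ∈ support) → (e , trim e e∈) ∈ₗ concatFin ch
    trimmed∈ e e∈ = ∈-concatFin⁺ ch e (subst ((e , trim e e∈) ∈ₗ_) (sym (proj₁ (proj₂ (selected e∈)))) (here refl))

    firstEdge : Cycle G trim → TrimmedHedge
    firstEdge cyc = Cycle.edge cyc zero , trim _ (Cycle.edge∈F cyc zero)

    closing-path : (cyc : Cycle G trim) → ∀ pre post → concatFin ch ≡ pre ++ firstEdge cyc ∷ post →
                   Path (pre ++ post) (ends₁ (firstEdge cyc)) (ends₂ (firstEdge cyc))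
    closing-path cyc pre post split = orient (joins zero)
      where
      open Cycle cyc
      step : ∀ (i : Fin len) → Edge (pre ++ post) (w (suc (inject₁ i))) (w (suc (suc i)))
      step i = (edge (suc i) , trim _ (edge∈F (suc i))) ,
               ∈-++-remove pre post (subst (_ ∈ₗ_) split (trimmed∈ _ (edge∈F (suc i))))
                 (λ eq → FP.0≢1+n (sym (edge-inj (cong label eq)))) ,
               joins (suc i)
      around : Path (pre ++ post) (w (suc zero)) (w zero)
      around = subst (Path (pre ++ post) (w (suc zero))) closed (consecutive⇒star (w ∘ suc) step (fromℕ len))
      orient : Joins G trim (edge zero) (edge∈F zero) (w zero) (w (suc zero)) →
               Path (pre ++ post) (ends₁ (firstEdge cyc)) (ends₂ (firstEdge cyc))
      orient (inj₁ (p , q)) rewrite p | q = path-sym around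
      orient (inj₂ (p , q)) rewrite p | q = around

    acyclic : Acyclic G trim
    acyclic cyc with ∈-∃++ (trimmed∈ _ (Cycle.edge∈F cyc zero))
    ... | pre , post , split = forest-bridge pre _ post (subst Forest split forest) (closing-path cyc pre post split)

  module FromIndependent {F : Subset (m G)} (τ : Trimming G F) (acyclic : Acyclic G τ) where

    ch : Fin (m G) → List TrimmedHedge
    ch e with e ∈? F
    ... | yes e∈ = (e , τ e e∈) ∷ []
    ... | no _ = []

    selection : ∀ {A} → F ⊆ A → Selection allTrims A ch
    selection F⊆A e with e ∈? F
    ... | yes e∈ = inj₂ (τ e e∈ , refl , F⊆A e∈ , hasCandidate (τ e e∈))
    ... | no _ = inj₁ refl

    length-ch : length (concatFin ch) ≡ ∣ F ∣
    length-ch = length-concatFin≡ ch F one none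
      where
      one : ∀ e → e ∈ F → length (ch e) ≡ 1
      one e e∈ with e ∈? F
      ... | yes _ = refl
      ... | no e∉ = ⊥-elim (e∉ e∈)
      none : ∀ e → e ∉ F → ch e ≡ []
      none e e∉ with e ∈? F
      ... | yes e∈ = ⊥-elim (e∉ e∈)
      ... | no _ = refl

    member : ∀ {z} → z ∈ₗ concatFin ch → Σ (label z ∈ F) λ p → proj₂ z ≡ τ (label z) p
    member z∈ with ∈-concatFin⁻ ch z∈
    ... | e , z∈e with e ∈? F
    member z∈ | e , here refl | yes e∈ = e∈ , refl

    same-label : ∀ {y z} → y ∈ₗ concatFin ch → z ∈ₗ concatFin ch → label y ≡ label z → y ≡ z
    same-label {e , t} {.e , t′} y∈ z∈ refl with member y∈ | member z∈
    ... | p , refl | p′ , refl = cong (λ p → e , τ e p) (∈-irrelevant p p′)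

    labels-distinct : Distinct (map label (concatFin ch))
    labels-distinct = distinct-labels label ch id (λ _ _ → id) labelled ≤1
      where
      labelled : ∀ e {z} → z ∈ₗ ch e → label z ≡ e
      labelled e z∈ with e ∈? F
      labelled e (here refl) | yes _ = refl
      ≤1 : ∀ e → length (ch e) ≤ 1
      ≤1 e with e ∈? F
      ... | yes _ = s≤s z≤n
      ... | no _ = z≤n

    joins : ∀ {z} (z∈ : z ∈ₗ concatFin ch) {a b} → Ends z a b → Joins G τ (label z) (proj₁ (member z∈)) a b
    joins {e , t} z∈ o with member z∈
    ... | _ , refl = o

    -- A path in the suffix after x between the ends of x, made simple,
    -- closes up with x into a cycle of the trimming.
    cycle : ∀ pre x post → concatFin ch ≡ pre ++ x ∷ post →
            SimplePaths.SimplePath (Edge post) (ends₂ x) (ends₁ x) → Cycle G τ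
    cycle pre x post split (rest , distinct , chain , last) = record
      { len = length rest ; w = w ; closed = last-lookup (ends₂ x) rest last
      ; w-inj = λ {i} {j} → w-inj i j ; edge = label ∘ cycleEdge ; edge-inj = λ {i} {j} → edge-inj i j
      ; edge∈F = λ i → proj₁ (member (cycleEdge∈ i)) ; joins = edge-joins }
      where
      open SimplePaths (Edge post)
      x∈ch : x ∈ₗ concatFin ch
      x∈ch = subst (_ ∈ₗ_) (sym split) (∈-insert pre)
      label-fresh : ∀ {y} → y ∈ₗ post → label x ≢ label y
      label-fresh y∈ eq = proj₁ (distinct-++⁻ʳ (map label pre)
        (subst Distinct (trans (cong (map label) split) (map-++ label pre _)) labels-distinct))
        (subst (_∈ₗ map label post) (sym eq) (∈-map⁺ label y∈))
      vertex : Fin (suc (length rest)) → Fin (n G)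
      vertex = L.lookup (ends₂ x ∷ rest)
      vertex-injective : ∀ i j → vertex i ≡ vertex j → i ≡ j
      vertex-injective = distinct⇒lookup-injective (ends₂ x ∷ rest) distinct
      step : ∀ i → Edge post (vertex (inject₁ i)) (vertex (suc i))
      step = chain-lookup (ends₂ x) rest chain
      w : Fin (suc (suc (length rest))) → Fin (n G)
      w zero = ends₁ x
      w (suc i) = vertex i
      w-inj : ∀ i j → w (inject₁ i) ≡ w (inject₁ j) → i ≡ j
      w-inj zero zero _ = refl
      w-inj zero (suc j) eq = ⊥-elim (FP.fromℕ≢inject₁ (vertex-injective _ (inject₁ j)
                                (trans (last-lookup (ends₂ x) rest last) eq)))
      w-inj (suc i) zero eq = ⊥-elim (FP.fromℕ≢inject₁ (vertex-injective _ (inject₁ i)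
                                (trans (last-lookup (ends₂ x) rest last) (sym eq))))
      w-inj (suc i) (suc j) eq = cong suc (FP.inject₁-injective (vertex-injective _ _ eq))
      y : Fin (length rest) → TrimmedHedge
      y i = proj₁ (step i)
      y∈post : ∀ i → y i ∈ₗ post
      y∈post i = proj₁ (proj₂ (step i))
      y-ends : ∀ i → Ends (y i) (vertex (inject₁ i)) (vertex (suc i))
      y-ends i = proj₂ (proj₂ (step i))
      cycleEdge : Fin (suc (length rest)) → TrimmedHedge
      cycleEdge zero = x
      cycleEdge (suc i) = y i
      cycleEdge∈ : ∀ i → cycleEdge i ∈ₗ concatFin ch
      cycleEdge∈ zero = x∈ch
      cycleEdge∈ (suc i) = subst (_ ∈ₗ_) (sym split) (∈-++⁺ʳ pre (there (y∈post i)))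
      edge-joins : ∀ i → Joins G τ (label (cycleEdge i)) (proj₁ (member (cycleEdge∈ i))) (w (inject₁ i)) (w (suc i))
      edge-joins zero = joins x∈ch (inj₁ (refl , refl))
      edge-joins (suc i) = joins (cycleEdge∈ (suc i)) (y-ends i)
      edge-inj : ∀ i j → label (cycleEdge i) ≡ label (cycleEdge j) → i ≡ j
      edge-inj zero zero _ = refl
      edge-inj zero (suc j) eq = ⊥-elim (label-fresh (y∈post j) eq)
      edge-inj (suc i) zero eq = ⊥-elim (label-fresh (y∈post i) (sym eq))
      edge-inj (suc i) (suc j) eq = cong suc (adjacent-pairs-injective vertex vertex-injective i j (y-ends i)
        (subst (λ z → Ends z (vertex (inject₁ j)) (vertex (suc j)))
               (sym (same-label (cycleEdge∈ (suc i)) (cycleEdge∈ (suc j)) eq)) (y-ends j)))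

    forest : Forest (concatFin ch)
    forest = suffix-acyclic⇒forest _ λ pre x post split p →
      acyclic (cycle pre x post split (SimplePaths.erase-loops (Edge post) (path-sym p)))

lemma3p2 : (G : Hedgegraph) (A : Subset (m G)) →
    Σ ℕ λ k → Rank G A k × MinBound G A k
lemma3p2 G A =
  k , ((support , support⊆A , (trim , acyclic) , ∣support∣) , maximal) ,
      ((cut , cut⊆A , n G ∸ components , (components , components⇒numComps cut cut-components , refl) , k≡) ,
       minimal)
  where
  open HedgeSystems G
  open HedgegraphTrimmings G
  open RadoWitness (rado A allTrims)
  open FromSelection selection forest
  k : ℕ
  k = length (concatFin choice)
  k≡ : k ≡ n G ∸ components + ∣ A ─ cut ∣
  k≡ = ≤-antisym
    (k+c≤n+d⇒k≤n∸c+d _ (components-≤ cut-components)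
      (selection-bound allTrims A choice selection forest cut cut-components))
    (n+d≤k+c⇒n∸c+d≤k _ (components-≤ cut-components) tight)
  maximal : ∀ F → F ⊆ A → Indep G F → ∣ F ∣ ≤ k
  maximal F F⊆A (τ , acyc) = subst (_≤ k) I.length-ch (+-cancelʳ-≤ components _ k
    (≤-trans (selection-bound allTrims A I.ch (I.selection F⊆A) I.forest cut cut-components) tight))
    where module I = FromIndependent τ acyc
  minimal : ∀ B → B ⊆ A → ∀ fB → PolyF G B fB → k ≤ fB + ∣ A ─ B ∣
  minimal B _ _ (c , comps , refl) = k+c≤n+d⇒k≤n∸c+d _ (components-≤ comps)
    (selection-bound allTrims A choice selection forest B (numComps⇒components B comps))
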